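{- Let $(a,b,c,r,s;x_t,y_t,x_h,y_h,x_k,y_k)$ be a set of solutions consisting of three pairs with $x_t<x_h<x_k$, $y_t<y_h$, $y_t<y_k$, and $y_h\ne y_k$. Then $y_h<y_k$, except when the set is in the same family as $(2,2,2,1,1;0,0,1,2,2,1)$.
   Context: For integers $a>1$, $b>1$, $c>0$, $r>0$, $s>0$, a solution of $(-1)^u r a^x + (-1)^v s b^y = c$ is a quadruple $(x,y,u,v)$ with $x,y$ nonnegative integers and $u,v\in\{0,1\}$; it is referred to by the pair $(x,y)$. A set of solutions $(a,b,c,r,s;x_1,y_1,\dots,x_N,y_N)$ is the set of $N>2$ distinct pairs, each a solution for the given $a,b,c,r,s$. Two sets of solutions $(a,b,c,r,s;x_1,y_1,\dots,x_N,y_N)$ and $(A,B,C,R,S;X_1,Y_1,\dots,X_N,Y_N)$ are in the same family if $a$ and $A$ are both powers of one integer, $b$ and $B$ are both powers of one integer, and there is a positive rational $k$ with $kc=C$ such that for every $i$ there is $j$ with $kra^{x_i}=RA^{X_j}$ and $ksb^{y_i}=SB^{Y_j}$. -}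

module Defs where

open import Data.Nat as ℕ using (ℕ; _<_)
open import Data.Integer as ℤ using (ℤ; +_; -1ℤ)
open import Data.Fin using (Fin; toℕ)
open import Data.Product using (_×_; _,_; ∃; ∃-syntax)
open import Data.List using (List; []; _∷_)
open import Data.List.Relation.Unary.All using (All)
open import Data.List.Relation.Unary.Any using (Any)
open import Data.List.Relation.Unary.Unique.Propositional using (Unique)
open import Relation.Binary.PropositionalEquality using (_≡_)

IsSolution : ℕ → ℕ → ℕ → ℕ → ℕ → ℕ × ℕ → Set
IsSolution a b c r s (x , y) =
  ∃[ u ] ∃[ v ]
    ( -1ℤ ℤ.^ toℕ {2} u ℤ.* (+ r) ℤ.* (+ a) ℤ.^ x
      ℤ.+ -1ℤ ℤ.^ toℕ {2} v ℤ.* (+ s) ℤ.* (+ b) ℤ.^ y ≡ + c )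

Params : ℕ → ℕ → ℕ → ℕ → ℕ → Set
Params a b c r s = (1 < a) × (1 < b) × (0 < c) × (0 < r) × (0 < s)

SetOfSolutions : ℕ → ℕ → ℕ → ℕ → ℕ → List (ℕ × ℕ) → Set
SetOfSolutions a b c r s L =
  Params a b c r s × (2 < Data.List.length L) × Unique L × All (IsSolution a b c r s) L

PowersOfOne : ℕ → ℕ → Set
PowersOfOne a A = ∃[ g ] ∃[ m ] ∃[ n ] (a ≡ g ℕ.^ m × A ≡ g ℕ.^ n)

-- same family; the positive rational k is written as p / q with p, q positive naturals
SameFamily : ℕ → ℕ → ℕ → ℕ → ℕ → List (ℕ × ℕ) →
             ℕ → ℕ → ℕ → ℕ → ℕ → List (ℕ × ℕ) → Set
SameFamily a b c r s L A B C R S L′ =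
  PowersOfOne a A × PowersOfOne b B ×
  ∃[ p ] ∃[ q ]
    ( (0 < p) × (0 < q) × (p ℕ.* c ≡ q ℕ.* C) ×
      All (λ { (x , y) → Any (λ { (X , Y) →
             (p ℕ.* (r ℕ.* a ℕ.^ x) ≡ q ℕ.* (R ℕ.* A ℕ.^ X)) ×
             (p ℕ.* (s ℕ.* b ℕ.^ y) ≡ q ℕ.* (S ℕ.* B ℕ.^ Y)) }) L′ }) L )

-- Suppose y_k < y_h.  With A = r a^x_t and B = s b^y_t the three solutions read
--   ε₁ A + φ₁ B = c,   ε₂ A N + φ₂ B M = c,   ε₃ A N′ + φ₃ B M′ = c
-- with signs εᵢ, φᵢ ∈ {±1}, N = a^(x_h−x_t) ≥ 2, N′ ≥ 2N, M′ = b^(y_k−y_t) ≥ 2 and M ≥ 2M′.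
-- Subtracting the first equation from the others gives A x = B y and A x′ = B y′ for
-- x = |ε₁ − ε₂N|, y = |φ₁ − φ₂M|, x′ = |ε₁ − ε₃N′|, y′ = |φ₁ − φ₃M′|, hence x y′ = x′ y.
-- But x ≤ N + 1 < x′ and y′ ≤ M′ + 1 < y, so equality forces x = x′ and y = y′; then
-- 2N ≤ N′ ≤ x + 1 ≤ N + 2 pins N = 2, N′ = 4, x = 3, and symmetrically M′ = 2, M = 4, y = 3.
-- So A = B, c = 2A and a = b = 2, and dividing by A gives (2,2,2,1,1;0,0,1,2,2,1).

module Submission where

open import Defs
open import Data.Nat as ℕ
  using (ℕ; zero; suc; _+_; _*_; _^_; _∸_; _≤_; _<_; z≤n; s≤s; s≤s⁻¹; >-nonZero)
import Data.Nat.Properties as ℕP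
import Data.Nat.Solver
open import Data.Integer as ℤ using (ℤ; +_; -1ℤ; ∣_∣)
import Data.Integer.Properties as ℤP
open import Data.Integer.Solver using (module +-*-Solver)
open import Data.Fin using (Fin; toℕ; zero; suc)
open import Data.Product using (_×_; _,_; ∃-syntax)
open import Data.Sum using (_⊎_; inj₁; inj₂)
open import Data.List using ([]; _∷_)
open import Data.List.Relation.Unary.All using ([]; _∷_)
open import Data.List.Relation.Unary.Any using (here; there)
open import Data.Empty using (⊥-elim)
open import Relation.Binary.Definitions using (tri<; tri≈; tri>)
open import Relation.Binary.PropositionalEquality
open ≡-Reasoning

*-squeeze : ∀ {x x′ y y′} → x ≤ x′ → y′ ≤ y → 0 < y → x * y′ ≡ x′ * y → x ≡ x′
*-squeeze {x} {x′} {y} {y′} x≤x′ y′≤y 0<y eq with ℕP.m≤n⇒m<n∨m≡n x≤x′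
... | inj₂ x≡x′ = x≡x′
... | inj₁ x<x′ = ⊥-elim (ℕP.<-irrefl eq (ℕP.≤-<-trans (ℕP.*-monoʳ-≤ x y′≤y)
                                                       (ℕP.*-monoˡ-< y {{>-nonZero 0<y}} x<x′)))

cross-cancel : ∀ {A B x y x′ y′} → 0 < A → 0 < B →
               A * x ≡ B * y → A * x′ ≡ B * y′ → x * y′ ≡ x′ * y
cross-cancel {A} {B} {x} {y} {x′} {y′} 0<A 0<B eq eq′ =
  ℕP.*-cancelˡ-≡ (x * y′) (x′ * y) (A * B)
    {{ℕP.m*n≢0 A B {{>-nonZero 0<A}} {{>-nonZero 0<B}}}} (begin
    A * B * (x * y′)     ≡⟨ interchange A B x y′ ⟩
    (A * x) * (B * y′)   ≡⟨ cong₂ _*_ eq (sym eq′) ⟩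
    (B * y) * (A * x′)   ≡⟨ ℕP.*-comm (B * y) (A * x′) ⟩
    (A * x′) * (B * y)   ≡⟨ interchange A B x′ y ⟨
    A * B * (x′ * y)     ∎)
  where
  open Data.Nat.Solver.+-*-Solver
  interchange : ∀ a b c d → a * b * (c * d) ≡ (a * c) * (b * d)
  interchange = solve 4 (λ a b c d → a :* b :* (c :* d) := (a :* c) :* (b :* d)) refl

doubling-gap : ∀ {n n′ x} → 2 ≤ n → n + n ≤ n′ → n′ ≤ 1 + x → 1 + n ≤ x
doubling-gap {n} 2≤n n+n≤n′ n′≤1+x =
  s≤s⁻¹ (ℕP.≤-trans (ℕP.+-monoˡ-≤ n 2≤n) (ℕP.≤-trans n+n≤n′ n′≤1+x))

doubling-bound : ∀ {n n′ x} → n + n ≤ n′ → n′ ≤ 1 + x → x ≤ 1 + n → n ≤ 2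
doubling-bound {n} n+n≤n′ n′≤1+x x≤1+n =
  ℕP.+-cancelʳ-≤ n n 2 (ℕP.≤-trans n+n≤n′ (ℕP.≤-trans n′≤1+x (s≤s x≤1+n)))

doubling-squeeze : ∀ {n n′ x} → 2 ≤ n → n + n ≤ n′ → n′ ≤ 1 + x → x ≤ 1 + n →
                   n ≡ 2 × n′ ≡ 4 × x ≡ 3
doubling-squeeze 2≤n n+n≤n′ n′≤1+x x≤1+n
  with ℕP.≤-antisym (doubling-bound n+n≤n′ n′≤1+x x≤1+n) 2≤n
... | refl = refl , ℕP.≤-antisym (ℕP.≤-trans n′≤1+x (s≤s x≤1+n)) n+n≤n′
                  , ℕP.≤-antisym x≤1+n (s≤s⁻¹ (ℕP.≤-trans n+n≤n′ n′≤1+x))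

n+n≤n*k : ∀ n {k} → 2 ≤ k → n + n ≤ n * k
n+n≤n*k n 2≤k = ℕP.≤-trans (ℕP.≤-reflexive n+n≡n*2) (ℕP.*-monoʳ-≤ n 2≤k)
  where
  n+n≡n*2 : n + n ≡ n * 2
  n+n≡n*2 = trans (cong (_+_ n) (sym (ℕP.+-identityʳ n))) (ℕP.*-comm 2 n)

a≤a^n : ∀ {a n} → 0 < a → 0 < n → a ≤ a ^ n
a≤a^n {a@(suc _)} {suc n} _ _ = ℕP.m≤m*n a (a ^ n) {{ℕP.m^n≢0 a n}}

0<r*a^x : ∀ {r a} x → 0 < r → 0 < a → 0 < r * a ^ x
0<r*a^x {a = a} x 0<r 0<a = ℕP.*-mono-≤ 0<r (ℕP.m^n>0 a {{>-nonZero 0<a}} x)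

*-^-split : ∀ r a {x y} → x ≤ y → r * a ^ y ≡ r * a ^ x * a ^ (y ∸ x)
*-^-split r a {x} {y} x≤y = begin
  r * a ^ y                   ≡⟨ cong (λ e → r * a ^ e) (ℕP.m+[n∸m]≡n x≤y) ⟨
  r * a ^ (x + (y ∸ x))       ≡⟨ cong (r *_) (ℕP.^-distribˡ-+-* a x (y ∸ x)) ⟩
  r * (a ^ x * a ^ (y ∸ x))   ≡⟨ ℕP.*-assoc r (a ^ x) (a ^ (y ∸ x)) ⟨
  r * a ^ x * a ^ (y ∸ x)     ∎

geometric-triple : ∀ {a x y z} r → 1 < a → x < y → y < z →
  ∃[ N ] ∃[ N′ ] a ≤ N × N + N ≤ N′ × r * a ^ y ≡ r * a ^ x * N × r * a ^ z ≡ r * a ^ x * N′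
geometric-triple {a} {x} {y} {z} r 1<a x<y y<z =
  N , N * K , a≤a^n 0<a (ℕP.m<n⇒0<n∸m x<y) ,
  n+n≤n*k N (ℕP.≤-trans 1<a (a≤a^n 0<a (ℕP.m<n⇒0<n∸m y<z))) ,
  *-^-split r a (ℕP.<⇒≤ x<y) , (begin
    r * a ^ z            ≡⟨ *-^-split r a (ℕP.<⇒≤ y<z) ⟩
    r * a ^ y * K        ≡⟨ cong (_* K) (*-^-split r a (ℕP.<⇒≤ x<y)) ⟩
    r * a ^ x * N * K    ≡⟨ ℕP.*-assoc (r * a ^ x) N K ⟩
    r * a ^ x * (N * K)  ∎)
  where
  0<a : 0 < a
  0<a = ℕP.<⇒≤ 1<a
  N K : ℕ
  N = a ^ (y ∸ x)
  K = a ^ (z ∸ y)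

sign : Fin 2 → ℤ
sign u = -1ℤ ℤ.^ toℕ u

∣sign∣≡1 : ∀ u → ∣ sign u ∣ ≡ 1
∣sign∣≡1 zero       = refl
∣sign∣≡1 (suc zero) = refl

∣sign*n∣≡n : ∀ u n → ∣ sign u ℤ.* + n ∣ ≡ n
∣sign*n∣≡n u n = begin
  ∣ sign u ℤ.* + n ∣      ≡⟨ ℤP.abs-* (sign u) (+ n) ⟩
  ∣ sign u ∣ * n          ≡⟨ cong (_* n) (∣sign∣≡1 u) ⟩
  1 * n                   ≡⟨ ℕP.*-identityˡ n ⟩
  n                       ∎

SignedSum : ℕ → ℕ → ℕ → Set
SignedSum p q c = ∃[ u ] ∃[ v ] sign u ℤ.* + p ℤ.+ sign v ℤ.* + q ≡ + c

pos-^ : ∀ a n → (+ a) ℤ.^ n ≡ + (a ^ n)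
pos-^ a zero    = refl
pos-^ a (suc n) = trans (cong (+ a ℤ.*_) (pos-^ a n)) (sym (ℤP.pos-* a (a ^ n)))

isSolution⇒signedSum : ∀ a b c r s x y →
  IsSolution a b c r s (x , y) → SignedSum (r * a ^ x) (s * b ^ y) c
isSolution⇒signedSum a b c r s x y (u , v , eq) =
  u , v , trans (sym (cong₂ ℤ._+_ (signed-term u r a x) (signed-term v s b y))) eq
  where
  signed-term : ∀ u r a x → sign u ℤ.* + r ℤ.* (+ a) ℤ.^ x ≡ sign u ℤ.* + (r * a ^ x)
  signed-term u r a x = begin
    sign u ℤ.* + r ℤ.* (+ a) ℤ.^ x     ≡⟨ ℤP.*-assoc (sign u) (+ r) _ ⟩
    sign u ℤ.* (+ r ℤ.* (+ a) ℤ.^ x)   ≡⟨ cong (λ z → sign u ℤ.* (+ r ℤ.* z)) (pos-^ a x) ⟩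
    sign u ℤ.* (+ r ℤ.* + (a ^ x))     ≡⟨ cong (sign u ℤ.*_) (ℤP.pos-* r (a ^ x)) ⟨
    sign u ℤ.* + (r * a ^ x)           ∎

defect : Fin 2 → Fin 2 → ℕ → ℤ
defect u v n = sign u ℤ.- sign v ℤ.* + n

∣defect∣≤1+n : ∀ u v n → ∣ defect u v n ∣ ≤ 1 + n
∣defect∣≤1+n u v n =
  subst₂ (λ k m → ∣ defect u v n ∣ ≤ k + m) (∣sign∣≡1 u) (∣sign*n∣≡n v n)
         (ℤP.∣i-j∣≤∣i∣+∣j∣ (sign u) (sign v ℤ.* + n))

n≤1+∣defect∣ : ∀ u v n → n ≤ 1 + ∣ defect u v n ∣
n≤1+∣defect∣ u v n =
  subst₂ (λ m k → m ≤ k + ∣ defect u v n ∣)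
         (trans (cong ∣_∣ (i-[i-j]≡j (sign u) (sign v ℤ.* + n))) (∣sign*n∣≡n v n)) (∣sign∣≡1 u)
         (ℤP.∣i-j∣≤∣i∣+∣j∣ (sign u) (defect u v n))
  where
  open +-*-Solver
  i-[i-j]≡j : ∀ i j → i ℤ.- (i ℤ.- j) ≡ j
  i-[i-j]≡j = solve 2 (λ i j → i :- (i :- j) := j) refl

sums-with-common-value : ∀ (e₁ f₁ e₂ f₂ a b n m k : ℤ) →
  e₁ ℤ.* a ℤ.+ f₁ ℤ.* b ≡ k → e₂ ℤ.* (a ℤ.* n) ℤ.+ f₂ ℤ.* (b ℤ.* m) ≡ k →
  a ℤ.* (e₁ ℤ.- e₂ ℤ.* n) ≡ ℤ.- (b ℤ.* (f₁ ℤ.- f₂ ℤ.* m))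
sums-with-common-value e₁ f₁ e₂ f₂ a b n m k eq₁ eq₂ = begin
  a ℤ.* (e₁ ℤ.- e₂ ℤ.* n)       ≡⟨ rearrange e₁ f₁ e₂ f₂ a b n m ⟩
  rhs ℤ.+ (first ℤ.- second)    ≡⟨ cong₂ (λ p q → rhs ℤ.+ (p ℤ.- q)) eq₁ eq₂ ⟩
  rhs ℤ.+ (k ℤ.- k)             ≡⟨ cong (ℤ._+_ rhs) (ℤP.+-inverseʳ k) ⟩
  rhs ℤ.+ + 0                   ≡⟨ ℤP.+-identityʳ rhs ⟩
  rhs                           ∎
  where
  open +-*-Solver
  rhs first second : ℤ
  rhs = ℤ.- (b ℤ.* (f₁ ℤ.- f₂ ℤ.* m))
  first = e₁ ℤ.* a ℤ.+ f₁ ℤ.* b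
  second = e₂ ℤ.* (a ℤ.* n) ℤ.+ f₂ ℤ.* (b ℤ.* m)
  rearrange : ∀ e₁ f₁ e₂ f₂ a b n m →
    a ℤ.* (e₁ ℤ.- e₂ ℤ.* n) ≡ ℤ.- (b ℤ.* (f₁ ℤ.- f₂ ℤ.* m))
      ℤ.+ ((e₁ ℤ.* a ℤ.+ f₁ ℤ.* b) ℤ.- (e₂ ℤ.* (a ℤ.* n) ℤ.+ f₂ ℤ.* (b ℤ.* m)))
  rearrange = solve 8 (λ e₁ f₁ e₂ f₂ a b n m →
    a :* (e₁ :- e₂ :* n) := :- (b :* (f₁ :- f₂ :* m))
                            :+ ((e₁ :* a :+ f₁ :* b) :- (e₂ :* (a :* n) :+ f₂ :* (b :* m)))) refl

signedSums⇒defects : ∀ {A B N M c} u₁ v₁ u₂ v₂ →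
  sign u₁ ℤ.* + A ℤ.+ sign v₁ ℤ.* + B ≡ + c →
  sign u₂ ℤ.* + (A * N) ℤ.+ sign v₂ ℤ.* + (B * M) ≡ + c →
  A * ∣ defect u₁ u₂ N ∣ ≡ B * ∣ defect v₁ v₂ M ∣
signedSums⇒defects {A} {B} {N} {M} u₁ v₁ u₂ v₂ eq₁ eq₂ = begin
  A * ∣ defect u₁ u₂ N ∣                   ≡⟨ ℤP.abs-* (+ A) (defect u₁ u₂ N) ⟨
  ∣ + A ℤ.* defect u₁ u₂ N ∣               ≡⟨ cong ∣_∣ scaled-defects ⟩
  ∣ ℤ.- (+ B ℤ.* defect v₁ v₂ M) ∣         ≡⟨ ℤP.∣-i∣≡∣i∣ (+ B ℤ.* defect v₁ v₂ M) ⟩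
  ∣ + B ℤ.* defect v₁ v₂ M ∣               ≡⟨ ℤP.abs-* (+ B) (defect v₁ v₂ M) ⟩
  B * ∣ defect v₁ v₂ M ∣                   ∎
  where
  scaled-defects : + A ℤ.* defect u₁ u₂ N ≡ ℤ.- (+ B ℤ.* defect v₁ v₂ M)
  scaled-defects =
    sums-with-common-value (sign u₁) (sign v₁) (sign u₂) (sign v₂) (+ A) (+ B) (+ N) (+ M) _ eq₁
      (subst₂ (λ p q → sign u₂ ℤ.* p ℤ.+ sign v₂ ℤ.* q ≡ _) (ℤP.pos-* A N) (ℤP.pos-* B M) eq₂)

signedSum-diagonal : ∀ {A c} → 0 < A → 0 < c → SignedSum A A c → c ≡ 2 * A
signedSum-diagonal {suc A} {c} _ 0<c (u , v , eq) =
  diagonal u v (trans (ℤP.*-distribʳ-+ (+ suc A) (sign u) (sign v)) eq)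
  where
  diagonal : ∀ u v → (sign u ℤ.+ sign v) ℤ.* + suc A ≡ + c → c ≡ 2 * suc A
  diagonal zero       zero       eq = sym (ℤP.+-injective eq)
  diagonal zero       (suc zero) eq = ⊥-elim (ℕP.<-irrefl (ℤP.+-injective eq) 0<c)
  diagonal (suc zero) zero       eq = ⊥-elim (ℕP.<-irrefl (ℤP.+-injective eq) 0<c)
  diagonal (suc zero) (suc zero) ()

rigidity : ∀ {A B c N N′ M M′} → 0 < A → 0 < B → 0 < c →
  2 ≤ N → N + N ≤ N′ → 2 ≤ M′ → M′ + M′ ≤ M →
  SignedSum A B c → SignedSum (A * N) (B * M) c → SignedSum (A * N′) (B * M′) c →
  N ≡ 2 × N′ ≡ 4 × M′ ≡ 2 × M ≡ 4 × A ≡ B × c ≡ 2 * A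
rigidity {A} {B} {c} {N} {N′} {M} {M′} 0<A 0<B 0<c 2≤N N+N≤N′ 2≤M′ M′+M′≤M
         s₁@(u₁ , v₁ , eq₁) (u₂ , v₂ , eq₂) (u₃ , v₃ , eq₃) =
  conclude (doubling-squeeze 2≤N N+N≤N′ N′≤1+x x≤1+N)
           (doubling-squeeze 2≤M′ M′+M′≤M (n≤1+∣defect∣ v₁ v₂ M) y≤1+M′)
  where
  x y x′ y′ : ℕ
  x = ∣ defect u₁ u₂ N ∣
  y = ∣ defect v₁ v₂ M ∣
  x′ = ∣ defect u₁ u₃ N′ ∣
  y′ = ∣ defect v₁ v₃ M′ ∣
  Ax≡By : A * x ≡ B * y
  Ax≡By = signedSums⇒defects u₁ v₁ u₂ v₂ eq₁ eq₂
  Ax′≡By′ : A * x′ ≡ B * y′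
  Ax′≡By′ = signedSums⇒defects u₁ v₁ u₃ v₃ eq₁ eq₃
  x≤1+N : x ≤ 1 + N
  x≤1+N = ∣defect∣≤1+n u₁ u₂ N
  y′≤1+M′ : y′ ≤ 1 + M′
  y′≤1+M′ = ∣defect∣≤1+n v₁ v₃ M′
  1+N≤x′ : 1 + N ≤ x′
  1+N≤x′ = doubling-gap 2≤N N+N≤N′ (n≤1+∣defect∣ u₁ u₃ N′)
  1+M′≤y : 1 + M′ ≤ y
  1+M′≤y = doubling-gap 2≤M′ M′+M′≤M (n≤1+∣defect∣ v₁ v₂ M)
  x≤x′ : x ≤ x′
  x≤x′ = ℕP.≤-trans x≤1+N 1+N≤x′
  y′≤y : y′ ≤ y
  y′≤y = ℕP.≤-trans y′≤1+M′ 1+M′≤y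
  xy′≡x′y : x * y′ ≡ x′ * y
  xy′≡x′y = cross-cancel 0<A 0<B Ax≡By Ax′≡By′
  x≡x′ : x ≡ x′
  x≡x′ = *-squeeze x≤x′ y′≤y (ℕP.≤-trans (s≤s z≤n) 1+M′≤y) xy′≡x′y
  y′≡y : y′ ≡ y
  y′≡y = *-squeeze y′≤y x≤x′ (ℕP.≤-trans (s≤s z≤n) 1+N≤x′)
                   (trans (ℕP.*-comm y′ x) (trans xy′≡x′y (ℕP.*-comm x′ y)))
  N′≤1+x : N′ ≤ 1 + x
  N′≤1+x = subst (λ z → N′ ≤ 1 + z) (sym x≡x′) (n≤1+∣defect∣ u₁ u₃ N′)
  y≤1+M′ : y ≤ 1 + M′
  y≤1+M′ = subst (_≤ 1 + M′) y′≡y y′≤1+M′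
  conclude : N ≡ 2 × N′ ≡ 4 × x ≡ 3 → M′ ≡ 2 × M ≡ 4 × y ≡ 3 →
             N ≡ 2 × N′ ≡ 4 × M′ ≡ 2 × M ≡ 4 × A ≡ B × c ≡ 2 * A
  conclude (N≡2 , N′≡4 , x≡3) (M′≡2 , M≡4 , y≡3) =
    N≡2 , N′≡4 , M′≡2 , M≡4 , A≡B ,
    signedSum-diagonal 0<A 0<c (subst (λ z → SignedSum A z c) (sym A≡B) s₁)
    where
    A≡B : A ≡ B
    A≡B = ℕP.*-cancelʳ-≡ A B 3 (trans (cong (A *_) (sym x≡3)) (trans Ax≡By (cong (B *_) y≡3)))

sameFamily-scaled : ∀ a b c r s xt yt xh yh xk yk {A} → 0 < A → a ≡ 2 → b ≡ 2 → c ≡ 2 * A →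
  r * a ^ xt ≡ A → s * b ^ yt ≡ A → r * a ^ xh ≡ A * 2 → s * b ^ yh ≡ A * 4 →
  r * a ^ xk ≡ A * 4 → s * b ^ yk ≡ A * 2 →
  SameFamily a b c r s ((xt , yt) ∷ (xh , yh) ∷ (xk , yk) ∷ [])
             2 2 2 1 1 ((0 , 0) ∷ (1 , 2) ∷ (2 , 1) ∷ [])
sameFamily-scaled _ _ c _ _ _ _ _ _ _ _ {A} 0<A refl refl c≡2A eₜ fₜ eₕ fₕ eₖ fₖ =
  (2 , 1 , 1 , refl , refl) , (2 , 1 , 1 , refl , refl) , 1 , A , s≤s z≤n , 0<A ,
  trans (ℕP.*-identityˡ c) (trans c≡2A (ℕP.*-comm 2 A)) ,
  here (rescale (trans eₜ (sym (ℕP.*-identityʳ A))) , rescale (trans fₜ (sym (ℕP.*-identityʳ A)))) ∷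
  there (here (rescale eₕ , rescale fₕ)) ∷
  there (there (here (rescale eₖ , rescale fₖ))) ∷ []
  where
  rescale : ∀ {t K} → t ≡ A * K → 1 * t ≡ A * (1 * K)
  rescale {t} {K} t≡AK = trans (ℕP.*-identityˡ t) (trans t≡AK (cong (A *_) (sym (ℕP.*-identityˡ K))))

descending-y⇒sameFamily : ∀ a b c r s xt yt xh yh xk yk → Params a b c r s →
  IsSolution a b c r s (xt , yt) → IsSolution a b c r s (xh , yh) → IsSolution a b c r s (xk , yk) →
  xt < xh → xh < xk → yt < yk → yk < yh →
  SameFamily a b c r s ((xt , yt) ∷ (xh , yh) ∷ (xk , yk) ∷ [])
             2 2 2 1 1 ((0 , 0) ∷ (1 , 2) ∷ (2 , 1) ∷ [])
descending-y⇒sameFamily a b c r s xt yt xh yh xk yk (1<a , 1<b , 0<c , 0<r , 0<s)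
                        solₜ solₕ solₖ xt<xh xh<xk yt<yk yk<yh
  with geometric-triple r 1<a xt<xh xh<xk | geometric-triple s 1<b yt<yk yk<yh
... | N , N′ , a≤N , N+N≤N′ , eₕ , eₖ | M′ , M , b≤M′ , M′+M′≤M , fₖ , fₕ =
  let N≡2 , N′≡4 , M′≡2 , M≡4 , A≡B , c≡2A =
        rigidity 0<A 0<B 0<c (ℕP.≤-trans 1<a a≤N) N+N≤N′ (ℕP.≤-trans 1<b b≤M′) M′+M′≤M
          (solution⇒signedSum xt yt solₜ)
          (subst₂ (λ p q → SignedSum p q c) eₕ fₕ (solution⇒signedSum xh yh solₕ))
          (subst₂ (λ p q → SignedSum p q c) eₖ fₖ (solution⇒signedSum xk yk solₖ))
  in sameFamily-scaled a b c r s xt yt xh yh xk yk 0<A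
       (ℕP.≤-antisym (subst (a ≤_) N≡2 a≤N) 1<a) (ℕP.≤-antisym (subst (b ≤_) M′≡2 b≤M′) 1<b)
       c≡2A refl (sym A≡B)
       (trans eₕ (cong (A *_) N≡2)) (trans fₕ (cong₂ _*_ (sym A≡B) M≡4))
       (trans eₖ (cong (A *_) N′≡4)) (trans fₖ (cong₂ _*_ (sym A≡B) M′≡2))
  where
  solution⇒signedSum : ∀ x y → IsSolution a b c r s (x , y) → SignedSum (r * a ^ x) (s * b ^ y) c
  solution⇒signedSum = isSolution⇒signedSum a b c r s
  A : ℕ
  A = r * a ^ xt
  0<A : 0 < A
  0<A = 0<r*a^x xt 0<r (ℕP.<⇒≤ 1<a)
  0<B : 0 < s * b ^ yt
  0<B = 0<r*a^x yt 0<s (ℕP.<⇒≤ 1<b)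

lemma10 : (a b c r s xt yt xh yh xk yk : ℕ) →
    SetOfSolutions a b c r s ((xt , yt) ∷ (xh , yh) ∷ (xk , yk) ∷ []) →
    xt < xh → xh < xk → yt < yh → yt < yk → yh ≢ yk →
    yh < yk
      ⊎ SameFamily a b c r s ((xt , yt) ∷ (xh , yh) ∷ (xk , yk) ∷ [])
                   2 2 2 1 1 ((0 , 0) ∷ (1 , 2) ∷ (2 , 1) ∷ [])
lemma10 a b c r s xt yt xh yh xk yk (params , _ , _ , solₜ ∷ solₕ ∷ solₖ ∷ [])
        xt<xh xh<xk _ yt<yk yh≢yk with ℕP.<-cmp yh yk
... | tri< yh<yk _ _ = inj₁ yh<yk
... | tri≈ _ yh≡yk _ = ⊥-elim (yh≢yk yh≡yk)
... | tri> _ _ yk<yh =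
  inj₂ (descending-y⇒sameFamily a b c r s xt yt xh yh xk yk params solₜ solₕ solₖ
                                xt<xh xh<xk yt<yk yk<yh)
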